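{- Let $B\ge 3$ be odd, $d=(B+1)/2$, and $r$ an integer with $1\le r<B/2$. Let $\langle r\rangle$ be the cyclic subgroup of $\mathbb{Z}_d$ generated by $r$ and $S=\{d+x: x\in\langle r\rangle\}$ (with $x$ represented in $\{0,\dots,d-1\}$). Then $S$ is a cycle in $G[A(B,r)]$, i.e. $G[A(B,r)]$ contains a directed cycle whose vertex set is exactly $S$.
   Context: $A(B,r)$ is the $d\times d$ real matrix whose rows and columns are indexed by $\{d,d+1,\dots,B\}$, with entries (all unspecified entries are $0$): row $d$: $A_{d,d}=-d$, $A_{d,B+1-r}=2(B+1-r)$, and $A_{d,k}=k$ for $B+1-r<k\le B$; for $d<k\le d+r-1$: $A_{k,k}=-k$ and $A_{k,d+k-r}=d+k-r$; for $d+r\le k\le B$: $A_{k,k}=-k$ and $A_{k,k-r}=k-r$. For a square matrix $M$ with index set $I$, the underlying directed graph $G[M]$ has vertex set $I$ and a directed edge from $i$ to $j$ iff $M_{i,j}\ne 0$. -}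

module Defs where

open import Data.Nat using (ℕ; _+_; _*_; _∸_; _≤_; _<_; _/_; _≡ᵇ_; _<ᵇ_)
open import Data.Bool using (Bool; true; false; if_then_else_; _∧_)
open import Data.Integer using (ℤ; +_; -_)
open import Data.List using (List; _∷_; []; _++_; [_])
open import Data.List.Membership.Propositional using (_∈_)
open import Data.List.Relation.Unary.Unique.Propositional using (Unique)
open import Data.List.Relation.Unary.Linked using (Linked)
open import Data.Product using (Σ; ∃; _×_)
open import Function.Bundles using (_⇔_)
open import Relation.Binary.PropositionalEquality using (_≡_; _≢_)

dOf : ℕ → ℕ
dOf B = (B + 1) / 2

_≤ᵇ'_ : ℕ → ℕ → Bool
a ≤ᵇ' b = a <ᵇ (b + 1)

A : ℕ → ℕ → ℕ → ℕ → ℤ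
A B r i j =
  if i ≡ᵇ d then
    (if j ≡ᵇ d then - (+ d)
     else if j ≡ᵇ (B + 1 ∸ r) then + (2 * (B + 1 ∸ r))
     else if ((B + 1 ∸ r) <ᵇ j) ∧ (j ≤ᵇ' B) then + j
     else + 0)
  else if (d <ᵇ i) ∧ (i ≤ᵇ' (d + r ∸ 1)) then
    (if j ≡ᵇ i then - (+ i)
     else if j ≡ᵇ (d + i ∸ r) then + (d + i ∸ r)
     else + 0)
  else if ((d + r) ≤ᵇ' i) ∧ (i ≤ᵇ' B) then
    (if j ≡ᵇ i then - (+ i)
     else if j ≡ᵇ (i ∸ r) then + (i ∸ r)
     else + 0)
  else + 0
  where
  d = dOf B

Index : ℕ → ℕ → Set
Index B i = dOf B ≤ i × i ≤ B

Edge : ℕ → ℕ → ℕ → ℕ → Set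
Edge B r i j = Index B i × Index B j × A B r i j ≢ + 0

InCyclicSubgroup : ℕ → ℕ → ℕ → Set
InCyclicSubgroup d r x = x < d × ∃ λ k → ∃ λ q → k * r ≡ x + q * d

S : ℕ → ℕ → ℕ → Set
S B r v = ∃ λ x → InCyclicSubgroup (dOf B) r x × v ≡ dOf B + x

HasDirectedCycleOn : (ℕ → ℕ → Set) → (ℕ → Set) → Set
HasDirectedCycleOn E P =
  Σ ℕ λ x → Σ (List ℕ) λ xs →
    Unique (x ∷ xs) × Linked E (x ∷ xs ++ [ x ]) × (∀ v → (v ∈ (x ∷ xs)) ⇔ P v)

{-# OPTIONS --safe #-}
-- Write the indices as d + y with y < d and put c = d - r, so that c ≡ -r (mod d).
-- Every row d + y of A(B,r) has a nonzero off-diagonal entry in column d + ((y + c) mod d):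
-- the row d covers y = 0, the rows d < k < d + r cover 0 < y < r (where y + c < d), and
-- the rows k ≥ d + r cover y ≥ r (where (y + c) mod d = y - r).  Hence the vertices
-- d + (k c mod d), k = 0, 1, …, form a closed walk; its vertices up to the first return
-- to d are distinct, and they are exactly d + ⟨c⟩ = d + ⟨r⟩ = S.
module Submission where

open import Defs
open import Data.Bool using (true; false)
import Data.Integer as ℤ
import Data.Integer.Properties as ℤ
open import Data.List using (applyUpTo; _∷ʳ_)
open import Data.List.Properties using (applyUpTo-∷ʳ)
open import Data.List.Membership.Propositional using (_∈_)
open import Data.List.Relation.Unary.Linked using (Linked)
import Data.List.Relation.Unary.Any.Properties as Any
import Data.List.Relation.Unary.Linked.Properties as Linked
import Data.List.Relation.Unary.Unique.Propositional.Properties as Unique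
open import Data.Nat
open import Data.Nat.Properties
open import Data.Nat.DivMod
open import Data.Nat.Divisibility using (m%n≡0⇒n∣m; ∣n⇒∣m*n)
open import Data.Nat.Solver using (module +-*-Solver)
open import Data.Product using (∃; ∃-syntax; _×_; _,_; proj₁; proj₂)
open import Data.Sum using (inj₁; inj₂; [_,_]′)
open import Function using (_∘_)
open import Function.Bundles using (_⇔_; mk⇔; Equivalence)
open import Level using (Level)
open import Relation.Binary.PropositionalEquality
open import Relation.Nullary using (¬_; yes; no)
open import Relation.Nullary.Decidable using (dec-true; dec-false)
open import Relation.Unary using (Pred; Decidable)

open +-*-Solver using (solve; _:+_; _:*_; _:=_; con)

private
  variable
    p : Level
    m n i j : ℕ

Least : Pred ℕ p → Pred ℕ p
Least P m = P m × (∀ {k} → k < m → ¬ P k)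

module _ {P : Pred ℕ p} (P? : Decidable P) where

  least-above : ∀ k n → (∀ {j} → j < k → ¬ P j) → P (n + k) → ∃ (Least P)
  least-above k zero    none-below pk = k , pk , none-below
  least-above k (suc n) none-below pn+k with P? k
  ... | yes pk = k , pk , none-below
  ... | no ¬pk = least-above (suc k) n none-below′ (subst P (sym (+-suc n k)) pn+k)
    where
    none-below′ : ∀ {j} → j < suc k → ¬ P j
    none-below′ j<1+k = [ none-below , (λ { refl → ¬pk }) ]′ (m<1+n⇒m<n∨m≡n j<1+k)

  least : P n → ∃ (Least P)
  least {n} pn = least-above 0 n (λ ()) (subst P (sym (+-identityʳ n)) pn)

closedWalk⇒HasDirectedCycleOn :
  ∀ {E : ℕ → ℕ → Set} {P : ℕ → Set} (f : ℕ → ℕ) n →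
  (∀ k → E (f k) (f (suc k))) → f (suc n) ≡ f 0 →
  (∀ {i j} → i < j → j < suc n → f i ≢ f j) →
  (∀ i → P (f i)) → (∀ {v} → P v → ∃[ i ] i < suc n × v ≡ f i) →
  HasDirectedCycleOn E P
closedWalk⇒HasDirectedCycleOn {E} {P} f n step closes injective image⊆P P⊆image =
  f 0 , applyUpTo (f ∘ suc) n , Unique.applyUpTo⁺₁ f (suc n) injective , closed-walk ,
  λ v → mk⇔ to from
  where
  closed-walk : Linked E (applyUpTo f (suc n) ∷ʳ f 0)
  closed-walk = subst (λ x → Linked E (applyUpTo f (suc n) ∷ʳ x)) closes
    (subst (Linked E) (sym (applyUpTo-∷ʳ f (suc n))) (Linked.applyUpTo⁺₂ f (suc (suc n)) step))
  to : ∀ {v} → v ∈ applyUpTo f (suc n) → P v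
  to v∈ = let i , _ , v≡fi = Any.applyUpTo⁻ f v∈ in subst P (sym v≡fi) (image⊆P i)
  from : ∀ {v} → P v → v ∈ applyUpTo f (suc n)
  from pv = let i , i<1+n , v≡fi = P⊆image pv in Any.applyUpTo⁺ f v≡fi i<1+n

module _ {d : ℕ} .{{_ : NonZero d}} where

  0%d≡0 : 0 % d ≡ 0
  0%d≡0 = m<n⇒m%n≡m (>-nonZero⁻¹ d)

  [m%d+n]%d≡[m+n]%d : ∀ m n → (m % d + n) % d ≡ (m + n) % d
  [m%d+n]%d≡[m+n]%d m n = begin
    (m % d + n) % d         ≡⟨ %-distribˡ-+ (m % d) n d ⟩
    (m % d % d + n % d) % d ≡⟨ cong (λ x → (x + n % d) % d) (m%n%n≡m%n m d) ⟩
    (m % d + n % d) % d     ≡⟨ %-distribˡ-+ m n d ⟨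
    (m + n) % d             ∎
    where open ≡-Reasoning

  [m+n]%d≡[m+o]%d⇒n%d≡o%d : ∀ m n o → (m + n) % d ≡ (m + o) % d → n % d ≡ o % d
  [m+n]%d≡[m+o]%d⇒n%d≡o%d m n o eq = begin
    n % d                          ≡⟨ subtract-m n ⟩
    ((m + n) % d + m * pred d) % d ≡⟨ cong (λ x → (x + m * pred d) % d) eq ⟩
    ((m + o) % d + m * pred d) % d ≡⟨ subtract-m o ⟨
    o % d                          ∎
    where
    open ≡-Reasoning
    -- m * pred d is -m modulo d
    subtract-m : ∀ k → k % d ≡ ((m + k) % d + m * pred d) % d
    subtract-m k = begin
      k % d                          ≡⟨ [m+kn]%n≡m%n k m d ⟨
      (k + m * d) % d                ≡⟨ cong (λ e → (k + m * e) % d) (suc-pred d) ⟨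
      (k + m * suc (pred d)) % d     ≡⟨ cong (_% d) (solve 3 (λ k m q →
                                          k :+ m :* (con 1 :+ q) := m :+ k :+ m :* q) refl k m (pred d)) ⟩
      (m + k + m * pred d) % d       ≡⟨ [m%d+n]%d≡[m+n]%d (m + k) (m * pred d) ⟨
      ((m + k) % d + m * pred d) % d ∎

  *pred[d]-complement : ∀ {u v} → u + v ≡ d → ∀ k → k * pred d * u % d ≡ k * v % d
  *pred[d]-complement {u} {v} u+v≡d k =
    [m+n]%d≡[m+o]%d⇒n%d≡o%d (k * u) (k * pred d * u) (k * v) (begin
      (k * u + k * pred d * u) % d ≡⟨ cong (_% d) (solve 3 (λ k u q →
                                        k :* u :+ k :* q :* u := k :* u :* (con 1 :+ q)) refl k u (pred d)) ⟩
      k * u * suc (pred d) % d     ≡⟨ cong (λ e → k * u * e % d) (suc-pred d) ⟩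
      k * u * d % d                ≡⟨ m*n%n≡0 (k * u) d ⟩
      0                            ≡⟨ m*n%n≡0 k d ⟨
      k * d % d                    ≡⟨ cong (λ e → k * e % d) u+v≡d ⟨
      k * (u + v) % d              ≡⟨ cong (_% d) (*-distribˡ-+ k u v) ⟩
      (k * u + k * v) % d          ∎)
    where open ≡-Reasoning

inCyclicSubgroup⇔ : ∀ {d r x} .{{_ : NonZero d}} → InCyclicSubgroup d r x ⇔ (∃[ k ] x ≡ k * r % d)
inCyclicSubgroup⇔ {d} {r} {x} = mk⇔ to from
  where
  to : InCyclicSubgroup d r x → ∃[ k ] x ≡ k * r % d
  to (x<d , k , q , kr≡x+qd) = k , (begin
    x               ≡⟨ m<n⇒m%n≡m x<d ⟨
    x % d           ≡⟨ [m+kn]%n≡m%n x q d ⟨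
    (x + q * d) % d ≡⟨ cong (_% d) kr≡x+qd ⟨
    k * r % d       ∎)
    where open ≡-Reasoning
  from : ∃[ k ] x ≡ k * r % d → InCyclicSubgroup d r x
  from (k , refl) = m%n<n (k * r) d , k , k * r / d , m≡m%n+[m/n]*n (k * r) d

module Orbit (d c : ℕ) .{{_ : NonZero d}} where

  orbit : ℕ → ℕ
  orbit k = k * c % d

  orbit<d : ∀ k → orbit k < d
  orbit<d k = m%n<n (k * c) d

  orbit-zero : orbit 0 ≡ 0
  orbit-zero = 0%d≡0

  orbit-suc : ∀ k → orbit (suc k) ≡ (orbit k + c) % d
  orbit-suc k = begin
    (c + k * c) % d   ≡⟨ cong (_% d) (+-comm c (k * c)) ⟩
    (k * c + c) % d   ≡⟨ [m%d+n]%d≡[m+n]%d (k * c) c ⟨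
    (orbit k + c) % d ∎
    where open ≡-Reasoning

  orbit-d : orbit d ≡ 0
  orbit-d = trans (cong (_% d) (*-comm d c)) (m*n%n≡0 c d)

  orbit-cancel : ∀ i t → orbit (i + t) ≡ orbit i → orbit t ≡ 0
  orbit-cancel i t eq = trans
    ([m+n]%d≡[m+o]%d⇒n%d≡o%d (i * c) (t * c) 0 (begin
      (i * c + t * c) % d ≡⟨ cong (_% d) (*-distribʳ-+ c i t) ⟨
      orbit (i + t)       ≡⟨ eq ⟩
      orbit i             ≡⟨ cong (_% d) (+-identityʳ (i * c)) ⟨
      (i * c + 0) % d     ∎))
    0%d≡0
    where open ≡-Reasoning

  orbit-periodic : ∀ {m} → orbit m ≡ 0 → ∀ i l → orbit (i + l * m) ≡ orbit i
  orbit-periodic {m} orbit-m≡0 i l = begin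
    (i + l * m) * c % d       ≡⟨ cong (_% d) (solve 4 (λ i l m c →
                                   (i :+ l :* m) :* c := i :* c :+ l :* (m :* c)) refl i l m c) ⟩
    (i * c + l * (m * c)) % d ≡⟨ %-remove-+ʳ (i * c) (∣n⇒∣m*n l (m%n≡0⇒n∣m (m * c) d orbit-m≡0)) ⟩
    orbit i                   ∎
    where open ≡-Reasoning

  orbit-mod : ∀ {m} .{{_ : NonZero m}} → orbit m ≡ 0 → ∀ k → orbit k ≡ orbit (k % m)
  orbit-mod {m} orbit-m≡0 k =
    trans (cong orbit (m≡m%n+[m/n]*n k m)) (orbit-periodic orbit-m≡0 (k % m) (k / m))

  first-return : ∃ (Least (λ k → orbit (suc k) ≡ 0))
  first-return =
    least (λ k → orbit (suc k) ≟ 0) {pred d} (subst (λ e → orbit e ≡ 0) (sym (suc-pred d)) orbit-d)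

  last : ℕ
  last = proj₁ first-return

  orbit-return : orbit (suc last) ≡ 0
  orbit-return = proj₁ (proj₂ first-return)

  orbit≢0 : ∀ {t} → 0 < t → t ≤ last → orbit t ≢ 0
  orbit≢0 {suc k} _ k<last = proj₂ (proj₂ first-return) k<last

  orbit-injective : i < j → j ≤ last → orbit i ≢ orbit j
  orbit-injective {i} {j} i<j j≤last eq =
    orbit≢0 (m<n⇒0<n∸m i<j) (≤-trans (m∸n≤m j i) j≤last)
      (orbit-cancel i (j ∸ i) (trans (cong orbit (m+[n∸m]≡n (<⇒≤ i<j))) (sym eq)))

≡⇒≡ᵇ≡true : m ≡ n → (m ≡ᵇ n) ≡ true
≡⇒≡ᵇ≡true {m} {n} = dec-true (m ≟ n)

≢⇒≡ᵇ≡false : m ≢ n → (m ≡ᵇ n) ≡ false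
≢⇒≡ᵇ≡false {m} {n} = dec-false (m ≟ n)

<⇒<ᵇ≡true : m < n → (m <ᵇ n) ≡ true
<⇒<ᵇ≡true {m} {n} = dec-true (m <? n)

≤⇒<ᵇ+1≡true : m ≤ n → (m <ᵇ n + 1) ≡ true
≤⇒<ᵇ+1≡true {m} {n} m≤n = <⇒<ᵇ≡true (subst (m <_) (+-comm 1 n) (s≤s m≤n))

≰⇒<ᵇ+1≡false : ¬ m ≤ n → (m <ᵇ n + 1) ≡ false
≰⇒<ᵇ+1≡false {m} {n} m≰n = dec-false (m <? n + 1) (m≰n ∘ m<1+n⇒m≤n ∘ subst (m <_) (+-comm n 1))

m<n⇒m≤n∸1 : m < n → m ≤ n ∸ 1
m<n⇒m≤n∸1 {m} {n} m<n = subst (m ≤_) (pred[m∸n]≡m∸[1+n] n 0) (<⇒≤pred m<n)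

m≤n⇒n≰m∸1 : 0 < n → m ≤ n → ¬ n ≤ m ∸ 1
m≤n⇒n≰m∸1 0<n m≤n n≤m∸1 = <⇒≱ (∸-monoʳ-< z<s 0<n) (≤-trans n≤m∸1 (∸-monoˡ-≤ 1 m≤n))

module Rows (B r : ℕ) where

  d : ℕ
  d = dOf B

  A-first-row : i ≡ d → j ≢ d → j ≡ B + 1 ∸ r → A B r i j ≡ ℤ.+ (2 * j)
  A-first-row refl j≢d refl
    rewrite ≡⇒≡ᵇ≡true {d} refl
          | ≢⇒≡ᵇ≡false j≢d
          | ≡⇒≡ᵇ≡true {B + 1 ∸ r} refl = refl

  A-middle-row : d < i → i < d + r → j ≢ i → j ≡ d + i ∸ r → A B r i j ≡ ℤ.+ j
  A-middle-row {i} d<i i<d+r j≢i refl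
    rewrite ≢⇒≡ᵇ≡false (>⇒≢ d<i)
          | <⇒<ᵇ≡true d<i
          | ≤⇒<ᵇ+1≡true (m<n⇒m≤n∸1 i<d+r)
          | ≢⇒≡ᵇ≡false j≢i
          | ≡⇒≡ᵇ≡true {d + i ∸ r} refl = refl

  A-lower-row : d < i → d + r ≤ i → i ≤ B → j ≢ i → j ≡ i ∸ r → A B r i j ≡ ℤ.+ j
  A-lower-row {i} d<i d+r≤i i≤B j≢i refl
    rewrite ≢⇒≡ᵇ≡false (>⇒≢ d<i)
          | <⇒<ᵇ≡true d<i
          | ≰⇒<ᵇ+1≡false (m≤n⇒n≰m∸1 (≤-<-trans z≤n d<i) d+r≤i)
          | ≤⇒<ᵇ+1≡true d+r≤i
          | ≤⇒<ᵇ+1≡true i≤B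
          | ≢⇒≡ᵇ≡false j≢i
          | ≡⇒≡ᵇ≡true {i ∸ r} refl = refl

  entry⇒Edge : Index B i → Index B j → A B r i j ≡ ℤ.+ n → 0 < n → Edge B r i j
  entry⇒Edge i∈ j∈ Aij≡n 0<n =
    i∈ , j∈ , λ Aij≡0 → >⇒≢ 0<n (ℤ.+-injective (trans (sym Aij≡n) Aij≡0))

module RotationCycle (B r : ℕ) (B+1≡d+d : B + 1 ≡ dOf B + dOf B) (0<r : 0 < r) (r<d : r < dOf B) where

  open Rows B r

  c : ℕ
  c = d ∸ r

  r≤d : r ≤ d
  r≤d = <⇒≤ r<d

  0<c : 0 < c
  0<c = m<n⇒0<n∸m r<d

  c<d : c < d
  c<d = ∸-monoʳ-< 0<r r≤d

  0<d : 0 < d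
  0<d = <-trans 0<r r<d

  0<d+ : ∀ y → 0 < d + y
  0<d+ y = <-≤-trans 0<d (m≤m+n d y)

  instance
    d-nonZero : NonZero d
    d-nonZero = >-nonZero 0<d

  r+c≡d : r + c ≡ d
  r+c≡d = m+[n∸m]≡n r≤d

  c+r≡d : c + r ≡ d
  c+r≡d = trans (+-comm c r) r+c≡d

  index : ∀ {y} → y < d → Index B (d + y)
  index {y} y<d =
    m≤m+n d y , m<1+n⇒m≤n (subst (d + y <_) (trans (sym B+1≡d+d) (+-comm B 1)) (+-monoʳ-< d y<d))

  edge-up : ∀ {y} → y < r → Edge B r (d + y) (d + (y + c))
  edge-up {zero} _ =
    entry⇒Edge (index 0<d) (index c<d)
      (A-first-row (+-identityʳ d) (>⇒≢ (m<m+n d 0<c)) d+c≡B+1∸r)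
      (≤-trans (0<d+ c) (m≤m+n (d + c) _))
    where
    d+c≡B+1∸r : d + c ≡ B + 1 ∸ r
    d+c≡B+1∸r = sym (trans (cong (_∸ r) B+1≡d+d) (+-∸-assoc d r≤d))
  edge-up {y@(suc _)} y<r =
    entry⇒Edge (index (<-trans y<r r<d)) (index y+c<d)
      (A-middle-row (m<m+n d z<s) (+-monoʳ-< d y<r) (>⇒≢ (+-monoʳ-< d (m<m+n y 0<c))) d+[y+c]≡d+[d+y]∸r)
      (0<d+ (y + c))
    where
    y+c<d : y + c < d
    y+c<d = subst (y + c <_) r+c≡d (+-monoˡ-< c y<r)
    d+[y+c]≡d+[d+y]∸r : d + (y + c) ≡ d + (d + y) ∸ r
    d+[y+c]≡d+[d+y]∸r = sym (begin
      d + (d + y) ∸ r ≡⟨ +-∸-assoc d (≤-trans r≤d (m≤m+n d y)) ⟩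
      d + (d + y ∸ r) ≡⟨ cong (d +_) (+-∸-comm y r≤d) ⟩
      d + (c + y)     ≡⟨ cong (d +_) (+-comm c y) ⟩
      d + (y + c)     ∎)
      where open ≡-Reasoning

  edge-down : ∀ {y} → r ≤ y → y < d → Edge B r (d + y) (d + (y ∸ r))
  edge-down {y} r≤y y<d =
    entry⇒Edge (index y<d) (index (≤-<-trans (m∸n≤m y r) y<d))
      (A-lower-row (m<m+n d (<-≤-trans 0<r r≤y)) (+-monoʳ-≤ d r≤y) (proj₂ (index y<d))
        (<⇒≢ (+-monoʳ-< d (∸-monoʳ-< 0<r r≤y))) (sym (+-∸-assoc d r≤y)))
      (0<d+ (y ∸ r))

  rotate-below : ∀ {y} → y < r → (y + c) % d ≡ y + c
  rotate-below {y} y<r = m<n⇒m%n≡m (subst (y + c <_) r+c≡d (+-monoˡ-< c y<r))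

  rotate-above : ∀ {y} → r ≤ y → y < d → (y + c) % d ≡ y ∸ r
  rotate-above {y} r≤y y<d = begin
    (y + c) % d           ≡⟨ cong (λ x → (x + c) % d) (m∸n+n≡m r≤y) ⟨
    (y ∸ r + r + c) % d   ≡⟨ cong (_% d) (+-assoc (y ∸ r) r c) ⟩
    (y ∸ r + (r + c)) % d ≡⟨ cong (λ x → (y ∸ r + x) % d) r+c≡d ⟩
    (y ∸ r + d) % d       ≡⟨ [m+n]%n≡m%n (y ∸ r) d ⟩
    (y ∸ r) % d           ≡⟨ m<n⇒m%n≡m (≤-<-trans (m∸n≤m y r) y<d) ⟩
    y ∸ r                 ∎
    where open ≡-Reasoning

  edge-rotate : ∀ {y} → y < d → Edge B r (d + y) (d + (y + c) % d)
  edge-rotate {y} y<d with <-≤-connex y r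
  ... | inj₁ y<r = subst (Edge B r (d + y) ∘ (d +_)) (sym (rotate-below y<r)) (edge-up y<r)
  ... | inj₂ r≤y = subst (Edge B r (d + y) ∘ (d +_)) (sym (rotate-above r≤y y<d)) (edge-down r≤y y<d)

  open Orbit d c

  vertex : ℕ → ℕ
  vertex k = d + orbit k

  edge-orbit : ∀ k → Edge B r (vertex k) (vertex (suc k))
  edge-orbit k = subst (Edge B r (vertex k) ∘ (d +_)) (sym (orbit-suc k)) (edge-rotate (orbit<d k))

  orbit∈S : ∀ i → S B r (vertex i)
  orbit∈S i =
    orbit i , Equivalence.from inCyclicSubgroup⇔ (i * pred d , sym (*pred[d]-complement r+c≡d i)) , refl

  S⊆orbit : ∀ {v} → S B r v → ∃[ i ] i < suc last × v ≡ vertex i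
  S⊆orbit (x , x∈⟨r⟩ , refl) with Equivalence.to inCyclicSubgroup⇔ x∈⟨r⟩
  ... | k , x≡kr%d = k * pred d % suc last , m%n<n (k * pred d) (suc last) , cong (d +_) (begin
    x                             ≡⟨ x≡kr%d ⟩
    k * r % d                     ≡⟨ *pred[d]-complement c+r≡d k ⟨
    orbit (k * pred d)            ≡⟨ orbit-mod orbit-return (k * pred d) ⟩
    orbit (k * pred d % suc last) ∎)
    where open ≡-Reasoning

  cycle : HasDirectedCycleOn (Edge B r) (S B r)
  cycle = closedWalk⇒HasDirectedCycleOn vertex last edge-orbit
    (cong (d +_) (trans orbit-return (sym orbit-zero)))
    (λ i<j j<1+last → orbit-injective i<j (m<1+n⇒m≤n j<1+last) ∘ +-cancelˡ-≡ d _ _)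
    orbit∈S S⊆orbit

B%2≡1⇒B+1≡dOf+dOf : ∀ {B} → B % 2 ≡ 1 → B + 1 ≡ dOf B + dOf B
B%2≡1⇒B+1≡dOf+dOf {B} B%2≡1 = begin
  B + 1         ≡⟨ m/n*n≡m (m%n≡0⇒n∣m (B + 1) 2 [B+1]%2≡0) ⟨
  dOf B * 2     ≡⟨ *-comm (dOf B) 2 ⟩
  2 * dOf B     ≡⟨ cong (dOf B +_) (+-identityʳ (dOf B)) ⟩
  dOf B + dOf B ∎
  where
  open ≡-Reasoning
  [B+1]%2≡0 : (B + 1) % 2 ≡ 0
  [B+1]%2≡0 = trans (%-distribˡ-+ B 1 2) (cong (λ x → (x + 1 % 2) % 2) B%2≡1)

2r<B⇒r<dOf : ∀ {B r} → B + 1 ≡ dOf B + dOf B → 2 * r < B → r < dOf B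
2r<B⇒r<dOf {B} {r} B+1≡d+d 2r<B = *-cancelˡ-< 2 r (dOf B) (begin-strict
  2 * r         <⟨ 2r<B ⟩
  B             <⟨ n<1+n B ⟩
  suc B         ≡⟨ +-comm 1 B ⟩
  B + 1         ≡⟨ B+1≡d+d ⟩
  dOf B + dOf B ≡⟨ cong (dOf B +_) (+-identityʳ (dOf B)) ⟨
  2 * dOf B     ∎)
  where open ≤-Reasoning

lemma4 : (B r : ℕ) → 3 ≤ B → B % 2 ≡ 1 → 1 ≤ r → 2 * r < B →
         HasDirectedCycleOn (Edge B r) (S B r)
lemma4 B r _ B%2≡1 0<r 2r<B =
  RotationCycle.cycle B r B+1≡d+d 0<r (2r<B⇒r<dOf B+1≡d+d 2r<B)
  where
  B+1≡d+d : B + 1 ≡ dOf B + dOf B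
  B+1≡d+d = B%2≡1⇒B+1≡dOf+dOf B%2≡1
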